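{- Let $u,v \in \mathcal{A}^*$. The words $u$ and $v$ lie in the same connected component of the quasi-crystal graph $\Gamma(\mathrm{hypo})$ if and only if $\mathrm{Q}_{\mathrm{sylv}}(u) = \mathrm{Q}_{\mathrm{sylv}}(v)$.
   Context: $\mathcal{A} = \{1,2,3,\ldots\}$ with the usual order; $\mathcal{A}^*$ the free monoid over $\mathcal{A}$. Quasi-Kashiwara operators $\ddot e_i,\ddot f_i$ ($i\in\mathbb{N}$): if $u$ contains a letter $i+1$ to the left of a letter $i$, both are undefined; otherwise $\ddot e_i(u)$ replaces the leftmost $i+1$ by $i$ (undefined if none) and $\ddot f_i(u)$ replaces the rightmost $i$ by $i+1$ (undefined if none). $\Gamma(\mathrm{hypo})$ is the directed graph on $\mathcal{A}^*$ with an edge $u \to v$ labelled $i$ iff $v = \ddot f_i(u)$; components are those of the underlying undirected graph. Right strict binary search tree insertion of a letter $a$: if the tree is empty create a node labelled $a$; otherwise recurse into the left subtree if $a \le$ root label and into the right subtree otherwise. For $u = a_1\cdots a_k$, start with empty trees $T_0$, $D_0$; for $i = 1,\ldots,k$, insert $a_{k-i+1}$ into $T_{i-1}$ to get $T_i$, and obtain $D_i$ from $D_{i-1}$ by adding a node labelled $k-i+1$ in the same position where $a_{k-i+1}$ was added. Then $\mathrm{Q}_{\mathrm{sylv}}(u) = D_k$ (a standard decreasing tree of the same shape as $T_k$). -}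

module Defs where

open import Data.Nat using (ℕ; zero; suc; _≤_; _≤?_; _≟_)
open import Data.Bool using (Bool; true; false; _∧_; _∨_; not)
open import Data.List using (List; []; _∷_; length)
open import Data.Maybe using (Maybe; just; nothing)
open import Data.Product using (Σ; _×_; _,_; proj₁; proj₂)
open import Relation.Nullary.Decidable using (⌊_⌋)
open import Relation.Nullary using (yes; no)
open import Relation.Binary.PropositionalEquality using (_≡_)
open import Relation.Binary.Construct.Closure.ReflexiveTransitive using (Star)
open import Relation.Binary.Construct.Closure.Symmetric using (SymClosure)

-- Alphabet 𝒜 = {1,2,3,...} with the usual order.  We encode the letter
-- k+1 of 𝒜 by the natural number k; this is an order isomorphism
-- ℕ ≅ 𝒜, and the operator index i ∈ {1,2,...} is encoded the same way
-- (so index i acts on letters i, i+1 in both encodings).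
Letter : Set
Letter = ℕ

Word : Set
Word = List Letter

_==_ : ℕ → ℕ → Bool
m == n = ⌊ m ≟ n ⌋

has : Letter → Word → Bool
has a []       = false
has a (x ∷ xs) = (x == a) ∨ has a xs

inversion : ℕ → Word → Bool
inversion i []       = false
inversion i (x ∷ xs) = ((x == suc i) ∧ has i xs) ∨ inversion i xs

replaceLeftmost : Letter → Letter → Word → Maybe Word
replaceLeftmost b c []       = nothing
replaceLeftmost b c (x ∷ xs) with x == b
... | true  = just (c ∷ xs)
... | false with replaceLeftmost b c xs
...   | just ys = just (x ∷ ys)
...   | nothing = nothing

replaceRightmost : Letter → Letter → Word → Maybe Word
replaceRightmost b c []       = nothing
replaceRightmost b c (x ∷ xs) with replaceRightmost b c xs
... | just ys = just (x ∷ ys)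
... | nothing with x == b
...   | true  = just (c ∷ xs)
...   | false = nothing

ë : ℕ → Word → Maybe Word
ë i u with inversion i u
... | true  = nothing
... | false = replaceLeftmost (suc i) i u

f̈ : ℕ → Word → Maybe Word
f̈ i u with inversion i u
... | true  = nothing
... | false = replaceRightmost i (suc i) u

Edge : Word → Word → Set
Edge u v = Σ ℕ (λ i → f̈ i u ≡ just v)

SameComponent : Word → Word → Set
SameComponent = Star (SymClosure Edge)

data Tree (A : Set) : Set where
  leaf : Tree A
  node : Tree A → A → Tree A → Tree A

-- right strict BST insertion of letter a, simultaneously placing the
-- label d at the same position in a tree of the same shape (trees of
-- pairs: first component = letter tree T, second = recording tree D)
insert : Letter → ℕ → Tree (Letter × ℕ) → Tree (Letter × ℕ)
insert a d leaf = node leaf (a , d) leaf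
insert a d (node l (r , e) t) with a ≤? r
... | yes _ = node (insert a d l) (r , e) t
... | no  _ = node l (r , e) (insert a d t)

mapTree : {A B : Set} → (A → B) → Tree A → Tree B
mapTree f leaf         = leaf
mapTree f (node l x r) = node (mapTree f l) (f x) (mapTree f r)

-- for u = a₁ ⋯ a_k, insert a_k, a_{k-1}, ..., a₁ (a_j with label j)
-- into the (pair) tree.  build (a_j ⋯ a_k) j performs insertions of
-- a_k, ..., a_j starting from the empty tree.
build : Word → ℕ → Tree (Letter × ℕ)
build []       j = leaf
build (a ∷ as) j = insert a j (build as (suc j))

Qsylv : Word → Tree ℕ
Qsylv u = mapTree proj₂ (build u 1)

-- Both conditions are equivalent to u and v having the same standardization,
-- i.e. the same relative order u_p ≤ u_q / v_p ≤ v_q for every pair of positions p < q.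
-- An edge raises the rightmost i to i+1 where no i+1 precedes it, which changes no such
-- comparison. Right strict insertion compares only via ≤, so the shapes and recording
-- labels of the trees depend on the standardization alone; conversely the inorder
-- reading of Q_sylv(u) lists the positions sorted by (letter, position), from which the
-- standardization is read off. Finally, if u ≠ v have the same standardization, then,
-- up to swapping u and v, let i+1 be least such that u exceeds v at a position holding
-- i+1; lowering the leftmost i+1 of u is the inverse of an edge, keeps the
-- standardization, and brings u one step closer to v.
module Submission where

open import Defs
open import Data.Bool using (true; false; _∧_; _∨_)
open import Data.Bool.Properties using (∧-zeroʳ; ∨-conicalˡ; ∨-conicalʳ; T-≡)
open import Data.List using (List; []; _∷_; _++_; map; zip; length)
open import Data.List.Properties using (map-++; ∷-injective; ++-assoc; ++-conicalʳ)
open import Data.List.Membership.Propositional using (_∈_; _∉_)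
open import Data.List.Membership.Propositional.Properties using (∈-map⁺; ∈-map⁻; ∈-++⁺ʳ; ∈-++⁻)
open import Data.List.Relation.Binary.Permutation.Propositional using (_↭_; ↭-refl; ↭-sym; ↭-trans; ↭-prep)
open import Data.List.Relation.Binary.Permutation.Propositional.Properties using (shift; All-resp-↭; ∈-resp-↭)
open import Data.List.Relation.Binary.Pointwise using (Pointwise; []; _∷_)
import Data.List.Relation.Binary.Pointwise.Properties as Pointwise
open import Data.List.Relation.Unary.All using (All; []; _∷_)
import Data.List.Relation.Unary.All as All
open import Data.List.Relation.Unary.All.Properties using (++⁺; ++⁻)
open import Data.List.Relation.Unary.Any using (Any; here; there; any?; satisfied)
open import Data.Maybe using (just; nothing)
open import Data.Nat using (ℕ; zero; suc; _≤_; _<_; _≤?_; _<?_; _≟_; z≤n; s≤s; s≤s⁻¹; ∣_-_∣; _+_)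
open import Data.Nat.Induction using (<-wellFounded)
open import Data.Nat.Properties
open import Data.Product using (∃-syntax; _×_; _,_; proj₁; proj₂; uncurry)
open import Data.Sum using (_⊎_; inj₁; inj₂)
open import Data.Unit using (⊤; tt)
open import Function using (_∘_; case_of_; _⇔_; mk⇔; Equivalence)
import Function.Properties.Equivalence as ⇔
open import Induction.WellFounded using (Acc; acc)
open import Relation.Binary.Definitions using (tri<; tri≈; tri>)
open import Relation.Binary.PropositionalEquality
open import Relation.Binary.Construct.Closure.ReflexiveTransitive using (ε; _◅_; _◅◅_)
open import Relation.Binary.Construct.Closure.Symmetric using (SymClosure; fwd; bwd)
open import Relation.Nullary using (¬_; Dec; yes; no; contradiction; _×-dec_)
open import Relation.Nullary.Decidable using (isYes≗does; dec-true; dec-false; toWitness)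

open Equivalence using (to; from)

-- The quasi-Kashiwara operator f̈ described positionally

==-refl : ∀ m → (m == m) ≡ true
==-refl m = trans (isYes≗does (m ≟ m)) (dec-true (m ≟ m) refl)

≢⇒==-false : ∀ {m n} → m ≢ n → (m == n) ≡ false
≢⇒==-false {m} {n} m≢n = trans (isYes≗does (m ≟ n)) (dec-false (m ≟ n) m≢n)

==⇒≡ : ∀ {m n} → (m == n) ≡ true → m ≡ n
==⇒≡ eq = toWitness (from T-≡ eq)

==-false⇒≢ : ∀ {m n} → (m == n) ≡ false → m ≢ n
==-false⇒≢ {m} eq refl = contradiction (trans (sym (==-refl m)) eq) λ ()

has≡false⇒∉ : ∀ {a xs} → has a xs ≡ false → a ∉ xs
has≡false⇒∉ {a} h (here refl) = ==-false⇒≢ {a} (∨-conicalˡ _ _ h) refl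
has≡false⇒∉ h (there a∈xs) = has≡false⇒∉ (∨-conicalʳ _ _ h) a∈xs

∉⇒has≡false : ∀ {a xs} → a ∉ xs → has a xs ≡ false
∉⇒has≡false {xs = []} a∉ = refl
∉⇒has≡false {xs = x ∷ xs} a∉
  rewrite ≢⇒==-false (a∉ ∘ here ∘ sym) | ∉⇒has≡false (a∉ ∘ there) = refl

∉⇒no-inversion : ∀ {i xs} → i ∉ xs → inversion i xs ≡ false
∉⇒no-inversion {xs = []} i∉ = refl
∉⇒no-inversion {i} {x ∷ xs} i∉
  rewrite ∉⇒has≡false (i∉ ∘ there) | ∧-zeroʳ (x == suc i) | ∉⇒no-inversion (i∉ ∘ there) = refl

no-inversion⇒∉ : ∀ {i x xs} → inversion i (x ∷ xs) ≡ false → x ≡ suc i → i ∉ xs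
no-inversion⇒∉ {i} {xs = xs} inv refl =
  has≡false⇒∉ (∨-conicalˡ _ _
    (subst (λ t → (t ∧ has i xs) ∨ inversion i xs ≡ false) (==-refl (suc i)) inv))

∉⇒replaceRightmost≡nothing : ∀ {b c xs} → b ∉ xs → replaceRightmost b c xs ≡ nothing
∉⇒replaceRightmost≡nothing {xs = []} b∉ = refl
∉⇒replaceRightmost≡nothing {b} {c} {x ∷ xs} b∉
  rewrite ∉⇒replaceRightmost≡nothing {c = c} (b∉ ∘ there) | ≢⇒==-false (b∉ ∘ here ∘ sym) = refl

replaceRightmost≡nothing⇒∉ : ∀ {b c xs} → replaceRightmost b c xs ≡ nothing → b ∉ xs
replaceRightmost≡nothing⇒∉ {b} {c} {x ∷ xs} eq b∈ with replaceRightmost b c xs in rr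
replaceRightmost≡nothing⇒∉ {b} {c} {x ∷ xs} () b∈ | just _
... | nothing with x == b in x==b
replaceRightmost≡nothing⇒∉ {b} {c} {x ∷ xs} () b∈ | nothing | true
... | false with b∈
...   | here b≡x   = ==-false⇒≢ x==b (sym b≡x)
...   | there b∈xs = replaceRightmost≡nothing⇒∉ rr b∈xs

data Raise (i : ℕ) : Word → Word → Set where
  here  : ∀ {ys} → i ∉ ys → Raise i (i ∷ ys) (suc i ∷ ys)
  there : ∀ {x xs ys} → x ≢ suc i → Raise i xs ys → Raise i (x ∷ xs) (x ∷ ys)

Raise⇒∈ : ∀ {i u v} → Raise i u v → i ∈ u
Raise⇒∈ (here _)    = here refl
Raise⇒∈ (there _ r) = there (Raise⇒∈ r)

Raise⇒no-inversion : ∀ {i u v} → Raise i u v → inversion i u ≡ false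
Raise⇒no-inversion {i} (here i∉)
  rewrite ∉⇒has≡false i∉ | ∧-zeroʳ (i == suc i) | ∉⇒no-inversion i∉ = refl
Raise⇒no-inversion (there x≢ r) rewrite ≢⇒==-false x≢ | Raise⇒no-inversion r = refl

Raise⇒replaceRightmost : ∀ {i u v} → Raise i u v → replaceRightmost i (suc i) u ≡ just v
Raise⇒replaceRightmost {i} (here i∉)
  rewrite ∉⇒replaceRightmost≡nothing {c = suc i} i∉ | ==-refl i = refl
Raise⇒replaceRightmost (there _ r) rewrite Raise⇒replaceRightmost r = refl

replaceRightmost⇒Raise : ∀ {i u v} → inversion i u ≡ false → replaceRightmost i (suc i) u ≡ just v →
                         Raise i u v
replaceRightmost⇒Raise {i} {x ∷ xs} inv eq with replaceRightmost i (suc i) xs in rr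
replaceRightmost⇒Raise {i} {x ∷ xs} inv refl | just ys = there x≢ r
  where
    r = replaceRightmost⇒Raise (∨-conicalʳ _ _ inv) rr
    x≢ : x ≢ suc i
    x≢ x≡ = no-inversion⇒∉ inv x≡ (Raise⇒∈ r)
... | nothing with x == i in x==i
replaceRightmost⇒Raise {i} {x ∷ xs} inv refl | nothing | true with refl ← ==⇒≡ x==i =
  here (replaceRightmost≡nothing⇒∉ rr)
replaceRightmost⇒Raise {i} {x ∷ xs} inv () | nothing | false

f̈⇒Raise : ∀ {i u v} → f̈ i u ≡ just v → Raise i u v
f̈⇒Raise {i} {u} eq with inversion i u in inv
f̈⇒Raise () | true
... | false = replaceRightmost⇒Raise inv eq

Raise⇒f̈ : ∀ {i u v} → Raise i u v → f̈ i u ≡ just v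
Raise⇒f̈ r rewrite Raise⇒no-inversion r = Raise⇒replaceRightmost r

-- Standardization

Agree : Letter → Letter → Letter → Letter → Set
Agree a b x y = a ≤ x ⇔ b ≤ y

-- Std u = Std v, recorded as the comparisons of each letter with all later ones.
data SameStd : Word → Word → Set where
  []  : SameStd [] []
  _∷_ : ∀ {a b as bs} → Pointwise (Agree a b) as bs → SameStd as bs → SameStd (a ∷ as) (b ∷ bs)

SameStd-refl : ∀ u → SameStd u u
SameStd-refl []       = []
SameStd-refl (_ ∷ as) = Pointwise.refl ⇔.refl ∷ SameStd-refl as

SameStd-sym : ∀ {u v} → SameStd u v → SameStd v u
SameStd-sym []      = []
SameStd-sym (p ∷ s) = Pointwise.symmetric ⇔.sym p ∷ SameStd-sym s

SameStd⇒length≡ : ∀ {u v} → SameStd u v → length u ≡ length v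
SameStd⇒length≡ []      = refl
SameStd⇒length≡ (_ ∷ s) = cong suc (SameStd⇒length≡ s)

≤⇔≤1+ : ∀ {a i} → a ≢ suc i → a ≤ i ⇔ a ≤ suc i
≤⇔≤1+ a≢ = mk⇔ m≤n⇒m≤1+n (λ a≤1+i → s≤s⁻¹ (≤∧≢⇒< a≤1+i a≢))

≤⇔1+≤ : ∀ {i x} → x ≢ i → i ≤ x ⇔ suc i ≤ x
≤⇔1+≤ x≢ = mk⇔ (λ i≤x → ≤∧≢⇒< i≤x (x≢ ∘ sym)) <⇒≤

lower-agreement : ∀ {i b xs ys} → i ∉ xs → Pointwise (Agree (suc i) b) xs ys → Pointwise (Agree i b) xs ys
lower-agreement i∉ []        = []
lower-agreement i∉ (ag ∷ p) = ⇔.trans (≤⇔1+≤ (i∉ ∘ here ∘ sym)) ag ∷ lower-agreement (i∉ ∘ there) p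

raise-agreement : ∀ {i a u v} → Raise i u v → a ≢ suc i → Pointwise (Agree a a) u v
raise-agreement (here _)    a≢ = ≤⇔≤1+ a≢ ∷ Pointwise.refl ⇔.refl
raise-agreement (there _ r) a≢ = ⇔.refl ∷ raise-agreement r a≢

Raise⇒SameStd : ∀ {i u v} → Raise i u v → SameStd u v
Raise⇒SameStd (here i∉)     = lower-agreement i∉ (Pointwise.refl ⇔.refl) ∷ SameStd-refl _
Raise⇒SameStd (there x≢ r) = raise-agreement r x≢ ∷ Raise⇒SameStd r

Edge⇒SameStd : ∀ {u v} → Edge u v → SameStd u v
Edge⇒SameStd (_ , eq) = Raise⇒SameStd (f̈⇒Raise eq)

Pointwise⇒All-zip : ∀ {A B : Set} {R : A → B → Set} {xs ys} → Pointwise R xs ys → All (uncurry R) (zip xs ys)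
Pointwise⇒All-zip []       = []
Pointwise⇒All-zip (r ∷ p) = r ∷ Pointwise⇒All-zip p

-- Same standardization implies the same recording tree

data Similar (R : Letter → Letter → Set) : Tree (Letter × ℕ) → Tree (Letter × ℕ) → Set where
  leaf : Similar R leaf leaf
  node : ∀ {l l′ r r′ x x′ d} → Similar R l l′ → R x x′ → Similar R r r′ →
         Similar R (node l (x , d) r) (node l′ (x′ , d) r′)

Similar-map : ∀ {R S T T′} → (∀ {x y} → R x y → S x y) → Similar R T T′ → Similar S T T′
Similar-map f leaf            = leaf
Similar-map f (node l rx r) = node (Similar-map f l) (f rx) (Similar-map f r)

Similar⇒labels≡ : ∀ {R T T′} → Similar R T T′ → mapTree proj₂ T ≡ mapTree proj₂ T′
Similar⇒labels≡ leaf           = refl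
Similar⇒labels≡ (node l _ r) = cong₂ (λ l r → node l _ r) (Similar⇒labels≡ l) (Similar⇒labels≡ r)

insert-Similar : ∀ {R a b d T T′} → (∀ {x x′} → R x x′ → Agree a b x x′) → R a b →
                 Similar R T T′ → Similar R (insert a d T) (insert b d T′)
insert-Similar agree rab leaf = node leaf rab leaf
insert-Similar {a = a} {b} agree rab (node {x = x} {x′} l rx r) with a ≤? x | b ≤? x′
... | yes _   | yes _    = node (insert-Similar agree rab l) rx r
... | yes a≤x | no b≰x′ = contradiction (to (agree rx) a≤x) b≰x′
... | no a≰x  | yes b≤x′ = contradiction (from (agree rx) b≤x′) a≰x
... | no _    | no _     = node l rx (insert-Similar agree rab r)

build-Similar : ∀ {as bs} → SameStd as bs → ∀ j →
                Similar (λ x y → (x , y) ∈ zip as bs) (build as j) (build bs j)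
build-Similar []      j = leaf
build-Similar {a ∷ as} {b ∷ bs} (p ∷ s) j =
  insert-Similar agree (here refl) (Similar-map there (build-Similar s (suc j)))
  where
    agree : ∀ {x y} → (x , y) ∈ zip (a ∷ as) (b ∷ bs) → Agree a b x y
    agree (here refl) = mk⇔ (λ _ → ≤-refl) (λ _ → ≤-refl)
    agree (there xy∈) = All.lookup (Pointwise⇒All-zip p) xy∈

SameStd⇒Qsylv≡ : ∀ {u v} → SameStd u v → Qsylv u ≡ Qsylv v
SameStd⇒Qsylv≡ s = Similar⇒labels≡ (build-Similar s 1)

-- The recording tree determines the standardization

inorder : {A : Set} → Tree A → List A
inorder leaf         = []
inorder (node l x r) = inorder l ++ x ∷ inorder r

inorder-mapTree : {A B : Set} (f : A → B) (T : Tree A) → inorder (mapTree f T) ≡ map f (inorder T)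
inorder-mapTree f leaf = refl
inorder-mapTree f (node l x r) = begin
  inorder (mapTree f l) ++ f x ∷ inorder (mapTree f r)
    ≡⟨ cong₂ (λ xs ys → xs ++ f x ∷ ys) (inorder-mapTree f l) (inorder-mapTree f r) ⟩
  map f (inorder l) ++ map f (x ∷ inorder r)
    ≡⟨ map-++ f (inorder l) (x ∷ inorder r) ⟨
  map f (inorder l ++ x ∷ inorder r)
    ∎
  where open ≡-Reasoning

BST : Tree (Letter × ℕ) → Set
BST leaf               = ⊤
BST (node l (x , _) r) =
  BST l × BST r × All ((_≤ x) ∘ proj₁) (inorder l) × All ((x <_) ∘ proj₁) (inorder r)

record InsertionSplit (a d : ℕ) (T T′ : Tree (Letter × ℕ)) : Set where
  field
    left right     : List (Letter × ℕ)
    inorder-T      : inorder T ≡ left ++ right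
    inorder-T′     : inorder T′ ≡ left ++ (a , d) ∷ right
    left<          : All ((_< a) ∘ proj₁) left
    ≤right         : All ((a ≤_) ∘ proj₁) right

insertionSplit : ∀ a d T → BST T → InsertionSplit a d T (insert a d T)
insertionSplit a d leaf _ = record
  { left = [] ; right = [] ; inorder-T = refl ; inorder-T′ = refl ; left< = [] ; ≤right = [] }
insertionSplit a d (node l (x , e) r) (bl , br , l≤x , x<r) with a ≤? x
... | yes a≤x = record
  { left           = left
  ; right          = right ++ (x , e) ∷ inorder r
  ; inorder-T      = trans (cong (_++ (x , e) ∷ inorder r) inorder-T) (++-assoc left right _)
  ; inorder-T′     = trans (cong (_++ (x , e) ∷ inorder r) inorder-T′) (++-assoc left _ _)
  ; left<          = left<
  ; ≤right         = ++⁺ ≤right (a≤x ∷ All.map (≤-trans a≤x ∘ <⇒≤) x<r)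
  }
  where open InsertionSplit (insertionSplit a d l bl)
... | no a≰x = record
  { left           = inorder l ++ (x , e) ∷ left
  ; right          = right
  ; inorder-T      = trans (cong ((inorder l ++_) ∘ ((x , e) ∷_)) inorder-T) (sym (++-assoc (inorder l) _ right))
  ; inorder-T′     = trans (cong ((inorder l ++_) ∘ ((x , e) ∷_)) inorder-T′) (sym (++-assoc (inorder l) _ _))
  ; left<          = ++⁺ (All.map (λ y≤x → ≤-<-trans y≤x (≰⇒> a≰x)) l≤x) (≰⇒> a≰x ∷ left<)
  ; ≤right         = ≤right
  }
  where open InsertionSplit (insertionSplit a d r br)

insert-↭ : ∀ {a d T} → BST T → inorder (insert a d T) ↭ (a , d) ∷ inorder T
insert-↭ {a} {d} {T} bst =
  subst₂ _↭_ (sym inorder-T′) (cong ((a , d) ∷_) (sym inorder-T)) (shift (a , d) left right)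
  where open InsertionSplit (insertionSplit a d T bst)

insert-BST : ∀ a d T → BST T → BST (insert a d T)
insert-BST a d leaf _ = tt , tt , [] , []
insert-BST a d (node l (x , e) r) (bl , br , l≤x , x<r) with a ≤? x
... | yes a≤x = insert-BST a d l bl , br , All-resp-↭ (↭-sym (insert-↭ bl)) (a≤x ∷ l≤x) , x<r
... | no a≰x  = bl , insert-BST a d r br , l≤x , All-resp-↭ (↭-sym (insert-↭ br)) (≰⇒> a≰x ∷ x<r)

build-BST : ∀ as j → BST (build as j)
build-BST []       j = tt
build-BST (a ∷ as) j = insert-BST a j _ (build-BST as (suc j))

indexed : Word → ℕ → List (Letter × ℕ)
indexed []       j = []
indexed (a ∷ as) j = (a , j) ∷ indexed as (suc j)

inorder-build-↭ : ∀ as j → inorder (build as j) ↭ indexed as j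
inorder-build-↭ []       j = ↭-refl
inorder-build-↭ (a ∷ as) j =
  ↭-trans (insert-↭ (build-BST as (suc j))) (↭-prep (a , j) (inorder-build-↭ as (suc j)))

indexed-label≥ : ∀ {as j x k} → (x , k) ∈ indexed as j → j ≤ k
indexed-label≥ {_ ∷ _} (here refl) = ≤-refl
indexed-label≥ {_ ∷ _} (there xk∈) = <⇒≤ (indexed-label≥ xk∈)

indexed-label-injective : ∀ {as j x y k} → (x , k) ∈ indexed as j → (y , k) ∈ indexed as j → x ≡ y
indexed-label-injective {_ ∷ _} (here refl) (here refl) = refl
indexed-label-injective {_ ∷ _} (here refl) (there yk∈) = contradiction (indexed-label≥ yk∈) (n≮n _)
indexed-label-injective {_ ∷ _} (there xk∈) (here refl) = contradiction (indexed-label≥ xk∈) (n≮n _)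
indexed-label-injective {_ ∷ _} (there xk∈) (there yk∈) = indexed-label-injective xk∈ yk∈

indexed-Pointwise : ∀ {R : Letter → Letter → Set} {as bs j} → length as ≡ length bs →
                    (∀ {x y k} → (x , k) ∈ indexed as j → (y , k) ∈ indexed bs j → R x y) → Pointwise R as bs
indexed-Pointwise {as = []}     {[]}     _  _ = []
indexed-Pointwise {as = _ ∷ _} {_ ∷ _} eq f =
  f (here refl) (here refl) ∷ indexed-Pointwise (suc-injective eq) (λ xk∈ yk∈ → f (there xk∈) (there yk∈))

labels : Tree (Letter × ℕ) → List ℕ
labels T = map proj₂ (inorder T)

∉-labels : ∀ {j} {ps : List (Letter × ℕ)} → All ((j <_) ∘ proj₂) ps → j ∉ map proj₂ ps
∉-labels {ps = _ ∷ _} (j<k ∷ _)  (here refl) = n≮n _ j<k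
∉-labels {ps = _ ∷ _} (_ ∷ j<ps) (there j∈) = ∉-labels j<ps j∈

-- Inserting a with the least label j cuts the inorder labels into those of letters < a
-- and those of letters ≥ a.
record LabelSplit (a : Letter) (as : Word) (j : ℕ) : Set where
  field
    below above : List ℕ
    labels-cons : labels (build (a ∷ as) j) ≡ below ++ j ∷ above
    labels-tail : labels (build as (suc j)) ≡ below ++ above
    j∉below     : j ∉ below
    j∉above     : j ∉ above
    ≤⇔above     : ∀ {x k} → (x , k) ∈ indexed as (suc j) → a ≤ x ⇔ k ∈ above

labelSplit : ∀ a as j → LabelSplit a as j
labelSplit a as j = record
  { below       = map proj₂ left
  ; above       = map proj₂ right
  ; labels-cons = trans (cong (map proj₂) inorder-T′) (map-++ proj₂ left _)
  ; labels-tail = trans (cong (map proj₂) inorder-T) (map-++ proj₂ left right)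
  ; j∉below     = ∉-labels (proj₁ labels>j)
  ; j∉above     = ∉-labels (proj₂ labels>j)
  ; ≤⇔above     = λ xk∈ → mk⇔ (≤⇒above xk∈) (above⇒≤ xk∈)
  }
  where
    T = build as (suc j)
    open InsertionSplit (insertionSplit a j T (build-BST as (suc j)))

    to-split : ∀ {p} → p ∈ indexed as (suc j) → p ∈ left ++ right
    to-split p∈ = subst (_ ∈_) inorder-T (∈-resp-↭ (↭-sym (inorder-build-↭ as (suc j))) p∈)

    from-right : ∀ {p} → p ∈ right → p ∈ indexed as (suc j)
    from-right p∈ = ∈-resp-↭ (inorder-build-↭ as (suc j)) (subst (_ ∈_) (sym inorder-T) (∈-++⁺ʳ left p∈))

    labels>j : All ((j <_) ∘ proj₂) left × All ((j <_) ∘ proj₂) right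
    labels>j = ++⁻ left (subst (All _) inorder-T
      (All-resp-↭ (↭-sym (inorder-build-↭ as (suc j))) (All.tabulate indexed-label≥)))

    ≤⇒above : ∀ {x k} → (x , k) ∈ indexed as (suc j) → a ≤ x → k ∈ map proj₂ right
    ≤⇒above xk∈ a≤x with ∈-++⁻ left (to-split xk∈)
    ... | inj₁ xk∈left  = contradiction a≤x (<⇒≱ (All.lookup left< xk∈left))
    ... | inj₂ xk∈right = ∈-map⁺ proj₂ xk∈right

    above⇒≤ : ∀ {x k} → (x , k) ∈ indexed as (suc j) → k ∈ map proj₂ right → a ≤ x
    above⇒≤ xk∈ k∈ with ∈-map⁻ proj₂ k∈
    ... | (y , k) , yk∈ , refl =
      subst (a ≤_) (indexed-label-injective (from-right yk∈) xk∈) (All.lookup ≤right yk∈)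

++-∷-injective : ∀ {j : ℕ} xs ys xs′ ys′ → j ∉ xs → j ∉ xs′ →
                 xs ++ j ∷ ys ≡ xs′ ++ j ∷ ys′ → xs ≡ xs′ × ys ≡ ys′
++-∷-injective []       ys []         ys′ _  _   eq = refl , proj₂ (∷-injective eq)
++-∷-injective []       ys (x′ ∷ xs′) ys′ _  j∉′ eq = contradiction (here (proj₁ (∷-injective eq))) j∉′
++-∷-injective (x ∷ xs) ys []         ys′ j∉ _   eq = contradiction (here (sym (proj₁ (∷-injective eq)))) j∉
++-∷-injective (x ∷ xs) ys (x′ ∷ xs′) ys′ j∉ j∉′ eq with ∷-injective eq
... | refl , eq′ with ++-∷-injective xs ys xs′ ys′ (j∉ ∘ there) (j∉′ ∘ there) eq′
...   | refl , refl = refl , refl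

labels-cons≢[] : ∀ a as j → labels (build (a ∷ as) j) ≢ []
labels-cons≢[] a as j eq = contradiction (++-conicalʳ below (j ∷ above) (trans (sym labels-cons) eq)) λ ()
  where open LabelSplit (labelSplit a as j)

labels≡⇒SameStd : ∀ u v j → labels (build u j) ≡ labels (build v j) → SameStd u v
labels≡⇒SameStd []       []       j eq = []
labels≡⇒SameStd []       (b ∷ bs) j eq = contradiction (sym eq) (labels-cons≢[] b bs j)
labels≡⇒SameStd (a ∷ as) []       j eq = contradiction eq (labels-cons≢[] a as j)
labels≡⇒SameStd (a ∷ as) (b ∷ bs) j eq = agree ∷ same-tail
  where
    module U = LabelSplit (labelSplit a as j)
    module V = LabelSplit (labelSplit b bs j)

    halves : U.below ≡ V.below × U.above ≡ V.above
    halves = ++-∷-injective _ _ _ _ U.j∉below V.j∉below (trans (sym U.labels-cons) (trans eq V.labels-cons))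

    same-tail : SameStd as bs
    same-tail = labels≡⇒SameStd as bs (suc j)
      (trans U.labels-tail (trans (cong₂ _++_ (proj₁ halves) (proj₂ halves)) (sym V.labels-tail)))

    agree : Pointwise (Agree a b) as bs
    agree = indexed-Pointwise (SameStd⇒length≡ same-tail) λ xk∈ yk∈ →
      ⇔.trans (subst (λ A → a ≤ _ ⇔ _ ∈ A) (proj₂ halves) (U.≤⇔above xk∈)) (⇔.sym (V.≤⇔above yk∈))

Qsylv≡⇒SameStd : ∀ {u v} → Qsylv u ≡ Qsylv v → SameStd u v
Qsylv≡⇒SameStd {u} {v} eq = labels≡⇒SameStd u v 1 (begin
  labels (build u 1) ≡⟨ inorder-mapTree proj₂ (build u 1) ⟨
  inorder (Qsylv u)  ≡⟨ cong inorder eq ⟩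
  inorder (Qsylv v)  ≡⟨ inorder-mapTree proj₂ (build v 1) ⟩
  labels (build v 1) ∎)
  where open ≡-Reasoning

-- Same standardization implies connectedness

ExceedsAt : ℕ → Word → Word → Set
ExceedsAt m u v = Any (λ (x , y) → x ≡ m × y < m) (zip u v)

exceedsAt? : ∀ m u v → Dec (ExceedsAt m u v)
exceedsAt? m u v = any? (λ (x , y) → x ≟ m ×-dec y <? m) (zip u v)

≡⊎exceeds : ∀ {u v} → SameStd u v → u ≡ v ⊎ (∃[ m ] ExceedsAt m u v) ⊎ (∃[ m ] ExceedsAt m v u)
≡⊎exceeds [] = inj₁ refl
≡⊎exceeds {a ∷ as} {b ∷ bs} (_ ∷ s) with <-cmp a b
... | tri< a<b _ _ = inj₂ (inj₂ (b , here (refl , a<b)))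
... | tri> _ _ b<a = inj₂ (inj₁ (a , here (refl , b<a)))
... | tri≈ _ refl _ with ≡⊎exceeds s
...   | inj₁ refl               = inj₁ refl
...   | inj₂ (inj₁ (m , exc)) = inj₂ (inj₁ (m , there exc))
...   | inj₂ (inj₂ (m , exc)) = inj₂ (inj₂ (m , there exc))

least-excess : ∀ {u v} m → ExceedsAt m u v → ∃[ i ] ExceedsAt (suc i) u v × ¬ ExceedsAt i u v
least-excess zero    exc = contradiction (proj₂ (proj₂ (satisfied exc))) (λ ())
least-excess {u} {v} (suc i) exc with exceedsAt? i u v
... | yes exc′ = least-excess i exc′
... | no ¬exc  = i , exc , ¬exc

excess-bound : ∀ {i b xs ys} → Pointwise (Agree (suc i) b) xs ys → ExceedsAt (suc i) xs ys → b ≤ i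
excess-bound (ag ∷ _) (here (refl , y<1+i)) = ≤-trans (to ag ≤-refl) (s≤s⁻¹ y<1+i)
excess-bound (_ ∷ p)  (there exc)            = excess-bound p exc

no-excess⇒∉ : ∀ {i b xs ys} → Pointwise (Agree (suc i) b) xs ys → b ≤ i → ¬ ExceedsAt i xs ys → i ∉ xs
no-excess⇒∉ (ag ∷ _) b≤i ¬exc (here refl) =
  ¬exc (here (refl , <-≤-trans (≰⇒> (n≮n _ ∘ from ag)) b≤i))
no-excess⇒∉ (_ ∷ p)  b≤i ¬exc (there i∈) = no-excess⇒∉ p b≤i (¬exc ∘ there) i∈

dist : Word → Word → ℕ
dist (a ∷ as) (b ∷ bs) = ∣ a - b ∣ + dist as bs
dist _        _        = 0

dist-sym : ∀ u v → dist u v ≡ dist v u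
dist-sym []       []       = refl
dist-sym []       (_ ∷ _)  = refl
dist-sym (_ ∷ _)  []       = refl
dist-sym (a ∷ as) (b ∷ bs) = cong₂ _+_ (∣-∣-comm a b) (dist-sym as bs)

∣1+m-n∣≡1+∣m-n∣ : ∀ {m n} → n ≤ m → ∣ suc m - n ∣ ≡ suc ∣ m - n ∣
∣1+m-n∣≡1+∣m-n∣ {m} z≤n     = cong suc (sym (∣-∣-identityʳ m))
∣1+m-n∣≡1+∣m-n∣ (s≤s n≤m) = ∣1+m-n∣≡1+∣m-n∣ n≤m

lower-excess : ∀ {i u v} → SameStd u v → ExceedsAt (suc i) u v → ¬ ExceedsAt i u v →
               ∃[ u′ ] Raise i u′ u × SameStd u′ v × dist u′ v < dist u v
lower-excess {i} {a ∷ as} {b ∷ bs} (p ∷ s) exc ¬exc with a ≟ suc i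
... | yes refl = i ∷ as , here i∉as , lower-agreement i∉as p ∷ s , closer
  where
    b≤i : b ≤ i
    b≤i = case exc of λ where
      (here (_ , b<1+i)) → s≤s⁻¹ b<1+i
      (there exc′)       → excess-bound p exc′
    i∉as : i ∉ as
    i∉as = no-excess⇒∉ p b≤i (¬exc ∘ there)
    closer : dist (i ∷ as) (b ∷ bs) < dist (suc i ∷ as) (b ∷ bs)
    closer rewrite ∣1+m-n∣≡1+∣m-n∣ b≤i = ≤-refl
... | no a≢1+i with exc
...   | here (a≡1+i , _) = contradiction a≡1+i a≢1+i
...   | there exc′ with lower-excess s exc′ (¬exc ∘ there)
...     | u′ , r , s′ , closer =
          a ∷ u′ , there a≢1+i r , Pointwise.transitive ⇔.trans (raise-agreement r a≢1+i) p ∷ s′ ,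
          +-monoʳ-< ∣ a - b ∣ closer

exceeds⇒Edge : ∀ {m u v} → SameStd u v → ExceedsAt m u v →
               ∃[ u′ ] Edge u′ u × SameStd u′ v × dist u′ v < dist u v
exceeds⇒Edge s exc with least-excess _ exc
... | i , exc′ , ¬exc with lower-excess s exc′ ¬exc
...   | u′ , r , s′ , closer = u′ , (i , Raise⇒f̈ r) , s′ , closer

SameStd⇒connected : ∀ {u v} → SameStd u v → Acc _<_ (dist u v) → SameComponent u v
SameStd⇒connected {u} {v} s (acc rec) with ≡⊎exceeds s
... | inj₁ refl = ε
... | inj₂ (inj₁ (_ , exc)) with exceeds⇒Edge s exc
...   | _ , edge , s′ , closer = bwd edge ◅ SameStd⇒connected s′ (rec closer)
SameStd⇒connected {u} {v} s (acc rec) | inj₂ (inj₂ (_ , exc)) with exceeds⇒Edge (SameStd-sym s) exc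
...   | v′ , edge , s′ , closer =
        SameStd⇒connected (SameStd-sym s′) (rec (subst₂ _<_ (dist-sym v′ u) (dist-sym v u) closer))
          ◅◅ fwd edge ◅ ε

adjacent⇒Qsylv≡ : ∀ {u v} → SymClosure Edge u v → Qsylv u ≡ Qsylv v
adjacent⇒Qsylv≡ {u}     (fwd edge) = SameStd⇒Qsylv≡ (Edge⇒SameStd {u} edge)
adjacent⇒Qsylv≡ {v = v} (bwd edge) = sym (SameStd⇒Qsylv≡ (Edge⇒SameStd {v} edge))

connected⇒Qsylv≡ : ∀ {u v} → SameComponent u v → Qsylv u ≡ Qsylv v
connected⇒Qsylv≡ ε       = refl
connected⇒Qsylv≡ (e ◅ p) = trans (adjacent⇒Qsylv≡ e) (connected⇒Qsylv≡ p)

proposition12 : (u v : Word) →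
    (SameComponent u v → Qsylv u ≡ Qsylv v) × (Qsylv u ≡ Qsylv v → SameComponent u v)
proposition12 u v =
  connected⇒Qsylv≡ , λ eq → SameStd⇒connected (Qsylv≡⇒SameStd eq) (<-wellFounded (dist u v))
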